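{- Let $\phi$ be a second-order formula over a vocabulary $\tau\cup\{R\}$, where $R$ is an $r$-ary relation symbol not in $\tau$. If $\phi$ is closed under substructures (resp. closed under extensions), then both $\exists R\phi$ and $\forall R\phi$ are closed under substructures (resp. closed under extensions).
   Context: All structures are finite. A formula $\phi$ is closed under substructures if for every structure $\mathcal A$ and every (induced) substructure $\mathcal B\subseteq\mathcal A$, $\mathcal A\models\phi$ implies $\mathcal B\models\phi$; it is closed under extensions if for every $\mathcal A$ and every extension $\mathcal B\supseteq\mathcal A$ (i.e. $\mathcal A$ is a substructure of $\mathcal B$), $\mathcal A\models\phi$ implies $\mathcal B\models\phi$. -}

module Defs where

open import Level using (Lift; lift) renaming (suc to lsuc; zero to lzero)
open import Data.Nat using (ℕ; zero; suc)
open import Data.Fin using (Fin; zero; suc)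
open import Data.List using (List; _∷_; length; lookup)
open import Data.Vec using (Vec; map)
open import Data.Product using (Σ; _×_; _,_)
open import Data.Sum using (_⊎_)
open import Data.Empty using (⊥)
open import Relation.Nullary using (¬_)
open import Relation.Binary.PropositionalEquality using (_≡_)
open import Function.Bundles using (_⇔_)
open import Function.Definitions using (Injective)

Vocab : Set
Vocab = List ℕ

Sym : Vocab → Set
Sym σ = Fin (length σ)

arity : (σ : Vocab) → Sym σ → ℕ
arity σ i = lookup σ i

RelOn : Set → ℕ → Set₁
RelOn U r = Vec U r → Set

record Structure (σ : Vocab) : Set₁ where
  field
    m   : ℕ
    rel : (i : Sym σ) → RelOn (Fin (suc m)) (arity σ i)

  U : Set
  U = Fin (suc m)

open Structure public

expand : ∀ {σ r} (A : Structure σ) → RelOn (U A) r → Structure (r ∷ σ)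
expand A R .m = A .m
expand A R .rel zero    = R
expand A R .rel (suc i) = A .rel i

-- Second-order quantifiers bind a fresh relation
-- symbol of given arity at the head of the vocabulary, so that for
-- φ : Formula (r ∷ τ) k the formulas ∃² r φ, ∀² r φ : Formula τ k are
-- ∃Rφ and ∀Rφ where R is the symbol with index zero.

data Formula (σ : Vocab) (k : ℕ) : Set where
  atom : (i : Sym σ) → Vec (Fin k) (arity σ i) → Formula σ k
  eq   : Fin k → Fin k → Formula σ k
  ⊤'   : Formula σ k
  ⊥'   : Formula σ k
  ¬'_  : Formula σ k → Formula σ k
  _∧'_ : Formula σ k → Formula σ k → Formula σ k
  _∨'_ : Formula σ k → Formula σ k → Formula σ k
  _⇒'_ : Formula σ k → Formula σ k → Formula σ k
  ∃¹   : Formula σ (suc k) → Formula σ k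
  ∀¹   : Formula σ (suc k) → Formula σ k
  ∃²   : (r : ℕ) → Formula (r ∷ σ) k → Formula σ k
  ∀²   : (r : ℕ) → Formula (r ∷ σ) k → Formula σ k

Sentence : Vocab → Set
Sentence σ = Formula σ 0

_▹_ : ∀ {k} {A : Set} → (Fin k → A) → A → Fin (suc k) → A
(ρ ▹ a) zero    = a
(ρ ▹ a) (suc x) = ρ x

Sat : ∀ {σ k} (A : Structure σ) → (Fin k → U A) → Formula σ k → Set₁
Sat A ρ (atom i xs) = Lift _ (A .rel i (map ρ xs))
Sat A ρ (eq x y)   = Lift _ (ρ x ≡ ρ y)
Sat A ρ ⊤'         = Lift _ (⊥ → ⊥)
Sat A ρ ⊥'         = Lift _ ⊥
Sat A ρ (¬' φ)     = ¬ Sat A ρ φ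
Sat A ρ (φ ∧' ψ)   = Sat A ρ φ × Sat A ρ ψ
Sat A ρ (φ ∨' ψ)   = Sat A ρ φ ⊎ Sat A ρ ψ
Sat A ρ (φ ⇒' ψ)   = Sat A ρ φ → Sat A ρ ψ
Sat A ρ (∃¹ φ)     = Σ (U A) λ a → Sat A (ρ ▹ a) φ
Sat A ρ (∀¹ φ)     = (a : U A) → Sat A (ρ ▹ a) φ
Sat A ρ (∃² r φ)   = Σ (RelOn (U A) r) λ R → Sat (expand A R) ρ φ
Sat A ρ (∀² r φ)   = (R : RelOn (U A) r) → Sat (expand A R) ρ φ

noVars : {A : Set} → Fin 0 → A
noVars ()

_⊨_ : ∀ {σ} → Structure σ → Sentence σ → Set₁
A ⊨ φ = Sat A noVars φ

-- B is (an isomorphic copy of) an induced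
-- substructure of A, written B ⊑ A, iff there is an injective map
-- f : U B → U A such that every relation of B is exactly the restriction
-- (pullback along f) of the corresponding relation of A.  Equivalently
-- A is an extension of B.

record _⊑_ {σ} (B A : Structure σ) : Set₁ where
  field
    emb       : U B → U A
    injective : Injective _≡_ _≡_ emb
    induced   : (i : Sym σ) (xs : Vec (U B) (arity σ i)) →
                B .rel i xs ⇔ A .rel i (map emb xs)

ClosedUnderSubstructures : ∀ {σ} → Sentence σ → Set₁
ClosedUnderSubstructures {σ} φ =
  (A B : Structure σ) → B ⊑ A → A ⊨ φ → B ⊨ φ

ClosedUnderExtensions : ∀ {σ} → Sentence σ → Set₁
ClosedUnderExtensions {σ} φ =
  (A B : Structure σ) → A ⊑ B → A ⊨ φ → B ⊨ φ

{-# OPTIONS --safe #-}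
-- An embedding e : B ⊑ A transports interpretations of the new symbol R in
-- both directions: a relation on A restricts along e to one on B, and a
-- relation on B has as image under e a relation on A that restricts back to
-- it (by injectivity).  Either way e lifts to an embedding of the expanded
-- structures, so closure of φ under substructures (extensions) passes to
-- ∃Rφ and ∀Rφ: for ∃ transport the witness along the embedding, for ∀
-- instantiate the hypothesis at the transported relation.
module Submission where

open import Defs
open import Data.Nat using (ℕ)
open import Data.Fin using (zero; suc)
open import Data.Product using (_×_; _,_; ∃)
open import Data.List using (_∷_)
open import Data.Vec using ([]; _∷_; map)
open import Data.Vec.Properties using (∷-injectiveˡ; ∷-injectiveʳ)
open import Relation.Binary.PropositionalEquality using (_≡_; refl; subst; cong₂)
open import Function.Base using (id)
open import Function.Bundles using (mk⇔)
open import Function.Definitions using (Injective)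

open _⊑_

map-injective : ∀ {X Y : Set} {f : X → Y} → Injective _≡_ _≡_ f →
                ∀ {n} → Injective _≡_ _≡_ (map {n = n} f)
map-injective f-inj {x = []}     {[]}     _  = refl
map-injective f-inj {x = x ∷ xs} {y ∷ ys} fxs≡fys =
  cong₂ _∷_ (f-inj (∷-injectiveˡ fxs≡fys)) (map-injective f-inj (∷-injectiveʳ fxs≡fys))

restrict : ∀ {σ r} {B A : Structure σ} → B ⊑ A → RelOn (U A) r → RelOn (U B) r
restrict e R xs = R (map (emb e) xs)

image : ∀ {σ r} {B A : Structure σ} → B ⊑ A → RelOn (U B) r → RelOn (U A) r
image e R ys = ∃ λ xs → map (emb e) xs ≡ ys × R xs

expand-restrict-⊑ : ∀ {σ r} {B A : Structure σ} (e : B ⊑ A) (R : RelOn (U A) r) →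
                    expand B (restrict e R) ⊑ expand A R
expand-restrict-⊑ e R .emb               = emb e
expand-restrict-⊑ e R .injective         = injective e
expand-restrict-⊑ e R .induced zero    _ = mk⇔ id id
expand-restrict-⊑ e R .induced (suc i)   = induced e i

expand-image-⊑ : ∀ {σ r} {B A : Structure σ} (e : B ⊑ A) (R : RelOn (U B) r) →
                 expand B R ⊑ expand A (image e R)
expand-image-⊑ e R .emb                = emb e
expand-image-⊑ e R .injective          = injective e
expand-image-⊑ e R .induced zero    xs =
  mk⇔ (λ Rxs → xs , refl , Rxs)
      (λ { (xs′ , exs′≡exs , Rxs′) → subst R (map-injective (injective e) exs′≡exs) Rxs′ })
expand-image-⊑ e R .induced (suc i)    = induced e i

module _ {τ : Vocab} {r : ℕ} {φ : Sentence (r ∷ τ)} where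

  ∃²-closedUnderSubstructures : ClosedUnderSubstructures φ →
                                ClosedUnderSubstructures (∃² r φ)
  ∃²-closedUnderSubstructures closed A B e (R , A,R⊨φ) =
    restrict e R , closed (expand A R) _ (expand-restrict-⊑ e R) A,R⊨φ

  ∀²-closedUnderSubstructures : ClosedUnderSubstructures φ →
                                ClosedUnderSubstructures (∀² r φ)
  ∀²-closedUnderSubstructures closed A B e A⊨∀φ R =
    closed _ (expand B R) (expand-image-⊑ e R) (A⊨∀φ (image e R))

  ∃²-closedUnderExtensions : ClosedUnderExtensions φ →
                             ClosedUnderExtensions (∃² r φ)
  ∃²-closedUnderExtensions closed A B e (R , A,R⊨φ) =
    image e R , closed (expand A R) _ (expand-image-⊑ e R) A,R⊨φ

  ∀²-closedUnderExtensions : ClosedUnderExtensions φ →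
                             ClosedUnderExtensions (∀² r φ)
  ∀²-closedUnderExtensions closed A B e A⊨∀φ R =
    closed _ (expand B R) (expand-restrict-⊑ e R) (A⊨∀φ (restrict e R))

lemma2 : (τ : Vocab) (r : ℕ) (φ : Sentence (r ∷ τ)) →
    (ClosedUnderSubstructures φ →
       ClosedUnderSubstructures (∃² r φ) × ClosedUnderSubstructures (∀² r φ))
    × (ClosedUnderExtensions φ →
       ClosedUnderExtensions (∃² r φ) × ClosedUnderExtensions (∀² r φ))
lemma2 τ r φ =
  (λ closed → ∃²-closedUnderSubstructures closed , ∀²-closedUnderSubstructures closed)
  , (λ closed → ∃²-closedUnderExtensions closed , ∀²-closedUnderExtensions closed)
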